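{- Let $n\geq 3$ and $\Gamma=\mathbb{Z}_n\oplus \mathbb{Z}_n$. Then there exists a $\Gamma$-magic square $\mathrm{MS}_{\Gamma}(n)$ of side $n$.
   Context: For an Abelian group $(\Gamma,+)$ of order $n^2$, a $\Gamma$-magic square $\mathrm{MS}_{\Gamma}(n)$ (of side $n$) is an $n\times n$ array whose entries are all the elements of $\Gamma$ (each element appearing exactly once) such that all row sums, all column sums, the sum along the main diagonal and the sum along the backward main diagonal are equal to the same element $\mu\in\Gamma$. $\mathbb{Z}_n$ denotes the cyclic group of order $n$. -}

module Defs where

open import Data.Nat using (ℕ; zero; suc; _+_; NonZero)
open import Data.Nat.DivMod using (_%_)
open import Data.Fin using (Fin; toℕ; fromℕ<; zero; suc)
open import Data.Nat.DivMod using (m%n<n)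
open import Data.Product using (_×_; _,_; proj₁; proj₂; ∃-syntax)
open import Function.Definitions using (Bijective)
import Data.Fin
open import Relation.Binary.PropositionalEquality using (_≡_)

_+ₙ_ : ∀ {n} .{{_ : NonZero n}} → Fin n → Fin n → Fin n
_+ₙ_ {n} a b = fromℕ< (m%n<n (toℕ a + toℕ b) n)

0ₙ : ∀ {n} .{{_ : NonZero n}} → Fin n
0ₙ {suc n} = zero

Γ : ℕ → Set
Γ n = Fin n × Fin n

_⊕_ : ∀ {n} .{{_ : NonZero n}} → Γ n → Γ n → Γ n
(a , b) ⊕ (c , d) = (a +ₙ c) , (b +ₙ d)

0Γ : ∀ {n} .{{_ : NonZero n}} → Γ n
0Γ = 0ₙ , 0ₙ

sumΓ : ∀ {n} .{{_ : NonZero n}} {k} → (Fin k → Γ n) → Γ n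
sumΓ {k = zero} f = 0Γ
sumΓ {k = suc k} f = f zero ⊕ sumΓ (λ i → f (suc i))

opposite : ∀ {m} → Fin m → Fin m
opposite = Data.Fin.opposite

IsMagicSquare : (n : ℕ) .{{_ : NonZero n}} → (Fin n → Fin n → Γ n) → Set
IsMagicSquare n A =
  Bijective _≡_ _≡_ (λ (p : Fin n × Fin n) → A (proj₁ p) (proj₂ p))
  × ∃[ μ ] ( (∀ i → sumΓ (λ j → A i j) ≡ μ)
           × (∀ j → sumΓ (λ i → A i j) ≡ μ)
           × (sumΓ (λ i → A i i) ≡ μ)
           × (sumΓ (λ i → A i (opposite i)) ≡ μ))

-- For odd n = 2k + 1 the square A i j = (i , j) is magic with μ = 0: in each coordinate a line
-- is either constant, summing to n i ≡ 0, or runs once through ℤₙ, summing to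
-- 0 + 1 + ⋯ + (n - 1) = n k ≡ 0.
--
-- For even n = 2k the same square has diagonal sums (k , k) but row sums (0 , k) and column
-- sums (k , 0), so every row and column must gain an extra k in its constant coordinate.
-- Write an index as i = a + k s with a < k and a bit s, so that adding k to i flips s.  In the
-- 2 × 2 block of cells with residues (a , b) apply the shear (s , t) ↦ (s ⊕ t , t) if b = f a,
-- the shear (s , t) ↦ (s , t ⊕ s) if a = g b, and nothing otherwise.  Each shear is an
-- involution of its block, so the square stays a bijection, and each flipped bit adds k to the
-- sums of the lines through its cell.  A row gets exactly one flip in its constant coordinate
-- (at b = f a, t = 1) and flips in pairs in the other one; symmetrically for columns; and the
-- diagonals get an even number of flips when f and g have an even number of fixed points and
-- meet the reflection a ↦ k - 1 - a an even number of times.  All line sums are then (k , k).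

module Submission where

open import Defs
open import Data.Nat using (ℕ; _≥_; NonZero)
open import Data.Fin using (Fin)
open import Data.Product using (∃-syntax)

open import Algebra.Bundles using (CommutativeMonoid; CommutativeRing; Monoid)
import Algebra.Properties.CommutativeMonoid.Sum as CommutativeMonoidSum
open import Algebra.Structures.Biased using (isCommutativeMonoidˡ)
open import Data.Bool using (Bool; true; false; not; _∧_; _xor_; if_then_else_)
open import Data.Bool.Properties using (xor-∧-commutativeRing; xor-assoc; xor-same; ∧-identityʳ; ∧-distribˡ-xor)
open import Data.Fin using (zero; suc; toℕ; fromℕ; fromℕ<; _↑ˡ_; _↑ʳ_; splitAt)
open import Data.Fin.Permutation using (reverse)
open import Data.Fin.Properties
  using (_≟_; 0≢1+n; toℕ-injective; toℕ-fromℕ<; toℕ<n; toℕ-↑ˡ; toℕ-↑ʳ; splitAt-↑ˡ; splitAt-↑ʳ; join-splitAt;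
         opposite-prop; opposite-involutive)
open import Data.Nat using (zero; suc; s≤s; _+_; _*_; _∸_; _<_; _%_; >-nonZero; >-nonZero⁻¹)
open import Data.Nat.DivMod using (%-distribˡ-+; m%n%n≡m%n; m<n⇒m%n≡m; m*n%n≡0; [m+kn]%n≡m%n; n%n≡0)
open import Data.Nat.Properties
  using (+-0-commutativeMonoid; +-comm; +-assoc; +-suc; *-comm; *-identityʳ; *-distribˡ-+; *-cancelˡ-≡;
         m<m+n; m≤m+n; <-≤-trans; +-monoˡ-<; +-∸-assoc; [m+n]∸[m+o]≡n∸o)
open import Data.Nat.Tactic.RingSolver using (solve-∀)
open import Data.Product using (_×_; _,_; proj₁; proj₂; uncurry)
open import Data.Sum using (_⊎_; inj₁; inj₂; [_,_]′)
open import Function using (_∘_; id)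
open import Function.Bundles using (Bijection; mk↔ₛ′; mk⇔)
open import Function.Definitions using (Bijective)
open import Function.Properties.Inverse using (↔⇒⤖)
open import Level using (0ℓ)
open import Relation.Binary.PropositionalEquality
  using (_≡_; _≢_; refl; sym; trans; cong; cong₂; module ≡-Reasoning)
open import Relation.Binary.PropositionalEquality.Algebra using (isMagma)
open import Relation.Nullary using (does; yes; no)
open import Relation.Nullary.Decidable using (dec-true; dec-false; does-⇔)

involution⇒bijective : ∀ {A : Set} (h : A → A) → (∀ x → h (h x) ≡ x) → Bijective _≡_ _≡_ h
involution⇒bijective h h∘h≡id = Bijection.bijective (↔⇒⤖ (mk↔ₛ′ h h h∘h≡id h∘h≡id))

xor-cancelˡ : ∀ x y → x xor (x xor y) ≡ y
xor-cancelˡ x y = trans (sym (xor-assoc x x y)) (cong (_xor y) (xor-same x))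

shear : Bool → Bool → Bool × Bool → Bool × Bool
shear h v (s , t) = (h ∧ t) xor s , (v ∧ s) xor t

shear-involutive : ∀ h v → h ∧ v ≡ false → ∀ p → shear h v (shear h v p) ≡ p
shear-involutive false v     _ (s , t) = cong (s ,_) (xor-cancelˡ (v ∧ s) t)
shear-involutive true  false _ (s , t) = cong (_, t) (xor-cancelˡ t s)

does-opposite-≟ : ∀ {n} (x y : Fin n) → does (opposite x ≟ y) ≡ does (x ≟ opposite y)
does-opposite-≟ x y = does-⇔ (mk⇔ (λ p → trans (sym (opposite-involutive x)) (cong opposite p))
                                  (λ q → trans (cong opposite q) (opposite-involutive y)))
                             (opposite x ≟ y) (x ≟ opposite y)

module _ {c ℓ} (M : Monoid c ℓ) where
  open Monoid M using (Carrier; _≈_; _∙_; ε; setoid; assoc; identityˡ; ∙-congˡ)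
  open import Algebra.Properties.Monoid.Sum M using (sum)
  open import Relation.Binary.Reasoning.Setoid setoid

  sum-↑ : ∀ {p q} (f : Fin (p + q) → Carrier) → sum f ≈ sum (f ∘ (_↑ˡ q)) ∙ sum (f ∘ (p ↑ʳ_))
  sum-↑ {zero}      f = begin sum f ≈⟨ identityˡ _ ⟨ ε ∙ sum f ∎
  sum-↑ {suc p} {q} f = begin
    f zero ∙ sum (f ∘ suc)                                              ≈⟨ ∙-congˡ (sum-↑ {p} (f ∘ suc)) ⟩
    f zero ∙ (sum (f ∘ suc ∘ (_↑ˡ q)) ∙ sum (f ∘ suc ∘ (p ↑ʳ_)))       ≈⟨ assoc _ _ _ ⟨
    (f zero ∙ sum (f ∘ suc ∘ (_↑ˡ q))) ∙ sum (f ∘ suc ∘ (p ↑ʳ_))       ∎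

module ℕΣ = CommutativeMonoidSum +-0-commutativeMonoid

xor-commutativeMonoid : CommutativeMonoid 0ℓ 0ℓ
xor-commutativeMonoid = CommutativeRing.+-commutativeMonoid xor-∧-commutativeRing

module XorΣ = CommutativeMonoidSum xor-commutativeMonoid

sum-does-≟ : ∀ {k} (c : Fin k) → XorΣ.sum (λ b → does (b ≟ c)) ≡ true
sum-does-≟ {suc k} zero    = cong (true xor_) (XorΣ.sum-replicate-zero k)
sum-does-≟ {suc k} (suc c) = sum-does-≟ c

sumℕ-const : ∀ m c → ℕΣ.sum {m} (λ _ → c) ≡ m * c
sumℕ-const zero    c = refl
sumℕ-const (suc m) c = cong (c +_) (sumℕ-const m c)

-- Arithmetic modulo n
[m+n%d]%d≡[m+n]%d : ∀ m n d .{{_ : NonZero d}} → (m + n % d) % d ≡ (m + n) % d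
[m+n%d]%d≡[m+n]%d m n d = begin
  (m + n % d) % d            ≡⟨ %-distribˡ-+ m (n % d) d ⟩
  (m % d + n % d % d) % d    ≡⟨ cong (λ x → (m % d + x) % d) (m%n%n≡m%n n d) ⟩
  (m % d + n % d) % d        ≡⟨ %-distribˡ-+ m n d ⟨
  (m + n) % d                ∎
  where open ≡-Reasoning

toℕ-0ₙ : ∀ {n} .{{_ : NonZero n}} → toℕ (0ₙ {n}) ≡ 0
toℕ-0ₙ {suc n} = refl

module _ {n : ℕ} .{{_ : NonZero n}} where

  toℕ-+ₙ : (a b : Fin n) → toℕ (a +ₙ b) ≡ (toℕ a + toℕ b) % n
  toℕ-+ₙ a b = toℕ-fromℕ< _

  +ₙ-comm : (a b : Fin n) → a +ₙ b ≡ b +ₙ a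
  +ₙ-comm a b = toℕ-injective (begin
    toℕ (a +ₙ b)              ≡⟨ toℕ-+ₙ a b ⟩
    (toℕ a + toℕ b) % n       ≡⟨ cong (_% n) (+-comm (toℕ a) (toℕ b)) ⟩
    (toℕ b + toℕ a) % n       ≡⟨ toℕ-+ₙ b a ⟨
    toℕ (b +ₙ a)              ∎)
    where open ≡-Reasoning

  +ₙ-assoc : (a b c : Fin n) → (a +ₙ b) +ₙ c ≡ a +ₙ (b +ₙ c)
  +ₙ-assoc a b c = toℕ-injective (begin
    toℕ ((a +ₙ b) +ₙ c)                    ≡⟨ toℕ-+ₙ (a +ₙ b) c ⟩
    (toℕ (a +ₙ b) + toℕ c) % n             ≡⟨ cong (λ x → (x + toℕ c) % n) (toℕ-+ₙ a b) ⟩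
    ((toℕ a + toℕ b) % n + toℕ c) % n      ≡⟨ cong (_% n) (+-comm ((toℕ a + toℕ b) % n) (toℕ c)) ⟩
    (toℕ c + (toℕ a + toℕ b) % n) % n      ≡⟨ [m+n%d]%d≡[m+n]%d (toℕ c) (toℕ a + toℕ b) n ⟩
    (toℕ c + (toℕ a + toℕ b)) % n          ≡⟨ cong (_% n) (+-comm (toℕ c) (toℕ a + toℕ b)) ⟩
    (toℕ a + toℕ b + toℕ c) % n            ≡⟨ cong (_% n) (+-assoc (toℕ a) (toℕ b) (toℕ c)) ⟩
    (toℕ a + (toℕ b + toℕ c)) % n          ≡⟨ [m+n%d]%d≡[m+n]%d (toℕ a) (toℕ b + toℕ c) n ⟨
    (toℕ a + (toℕ b + toℕ c) % n) % n      ≡⟨ cong (λ x → (toℕ a + x) % n) (toℕ-+ₙ b c) ⟨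
    (toℕ a + toℕ (b +ₙ c)) % n             ≡⟨ toℕ-+ₙ a (b +ₙ c) ⟨
    toℕ (a +ₙ (b +ₙ c))                    ∎)
    where open ≡-Reasoning

  +ₙ-identityˡ : (a : Fin n) → 0ₙ +ₙ a ≡ a
  +ₙ-identityˡ a = toℕ-injective (begin
    toℕ (0ₙ +ₙ a)               ≡⟨ toℕ-+ₙ 0ₙ a ⟩
    (toℕ (0ₙ {n}) + toℕ a) % n  ≡⟨ cong (λ x → (x + toℕ a) % n) toℕ-0ₙ ⟩
    toℕ a % n                   ≡⟨ m<n⇒m%n≡m (toℕ<n a) ⟩
    toℕ a                       ∎)
    where open ≡-Reasoning

  +ₙ-identityʳ : (a : Fin n) → a +ₙ 0ₙ ≡ a
  +ₙ-identityʳ a = trans (+ₙ-comm a 0ₙ) (+ₙ-identityˡ a)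

+ₙ-commutativeMonoid : (n : ℕ) .{{_ : NonZero n}} → CommutativeMonoid 0ℓ 0ℓ
+ₙ-commutativeMonoid n = record
  { isCommutativeMonoid = isCommutativeMonoidˡ record
    { isSemigroup = record { isMagma = isMagma (_+ₙ_ {n}) ; assoc = +ₙ-assoc }
    ; identityˡ   = +ₙ-identityˡ
    ; comm        = +ₙ-comm
    }
  }

module ℤₙΣ (n : ℕ) .{{_ : NonZero n}} = CommutativeMonoidSum (+ₙ-commutativeMonoid n)

module _ {n : ℕ} .{{_ : NonZero n}} where
  open ℤₙΣ n

  toℕ-sum : ∀ {m} (f : Fin m → Fin n) → toℕ (sum f) ≡ ℕΣ.sum (toℕ ∘ f) % n
  toℕ-sum {zero}  f = trans toℕ-0ₙ (sym (m<n⇒m%n≡m (>-nonZero⁻¹ n)))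
  toℕ-sum {suc m} f = begin
    toℕ (f zero +ₙ sum (f ∘ suc))                      ≡⟨ toℕ-+ₙ (f zero) _ ⟩
    (toℕ (f zero) + toℕ (sum (f ∘ suc))) % n           ≡⟨ cong (λ x → (toℕ (f zero) + x) % n) (toℕ-sum (f ∘ suc)) ⟩
    (toℕ (f zero) + ℕΣ.sum (toℕ ∘ f ∘ suc) % n) % n    ≡⟨ [m+n%d]%d≡[m+n]%d (toℕ (f zero)) _ n ⟩
    ℕΣ.sum (toℕ ∘ f) % n                                ∎
    where open ≡-Reasoning

  sum-const≡0ₙ : (a : Fin n) → sum {n} (λ _ → a) ≡ 0ₙ
  sum-const≡0ₙ a = toℕ-injective (begin
    toℕ (sum {n} (λ _ → a))     ≡⟨ toℕ-sum {n} (λ _ → a) ⟩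
    ℕΣ.sum {n} (λ _ → toℕ a) % n ≡⟨ cong (_% n) (trans (sumℕ-const n (toℕ a)) (*-comm n (toℕ a))) ⟩
    toℕ a * n % n               ≡⟨ m*n%n≡0 (toℕ a) n ⟩
    0                           ≡⟨ toℕ-0ₙ ⟨
    toℕ (0ₙ {n})                ∎)
    where open ≡-Reasoning

  sum-opposite : sum {n} opposite ≡ sum {n} id
  sum-opposite = sym (sum-permute id reverse)

  sumΓ-pair : ∀ {m} (F : Fin m → Γ n) → sumΓ F ≡ (sum (proj₁ ∘ F) , sum (proj₂ ∘ F))
  sumΓ-pair {zero}  F = refl
  sumΓ-pair {suc m} F = cong (F zero ⊕_) (sumΓ-pair (F ∘ suc))

triangle : ℕ → ℕ
triangle m = ℕΣ.sum {m} toℕ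

triangle-suc : ∀ m → triangle (suc m) ≡ m + triangle m
triangle-suc m = begin
  ℕΣ.sum {m} (λ i → 1 + toℕ i)           ≡⟨ ℕΣ.∑-distrib-+ {m} (λ _ → 1) toℕ ⟩
  ℕΣ.sum {m} (λ _ → 1) + triangle m      ≡⟨ cong (_+ triangle m) (trans (sumℕ-const m 1) (*-identityʳ m)) ⟩
  m + triangle m                         ∎
  where open ≡-Reasoning

triangle-double : ∀ m → 2 * triangle (suc m) ≡ suc m * m
triangle-double zero    = refl
triangle-double (suc m) = begin
  2 * triangle (suc (suc m))          ≡⟨ cong (2 *_) (triangle-suc (suc m)) ⟩
  2 * (suc m + triangle (suc m))      ≡⟨ *-distribˡ-+ 2 (suc m) _ ⟩
  2 * suc m + 2 * triangle (suc m)    ≡⟨ cong (2 * suc m +_) (triangle-double m) ⟩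
  2 * suc m + suc m * m               ≡⟨ lemma m ⟩
  suc (suc m) * suc m                 ∎
  where
  open ≡-Reasoning
  lemma : ∀ m → 2 * suc m + suc m * m ≡ suc (suc m) * suc m
  lemma = solve-∀

triangle-odd : ∀ k → triangle (suc (k + k)) ≡ k * suc (k + k)
triangle-odd k = *-cancelˡ-≡ _ _ 2 (trans (triangle-double (k + k)) (lemma k))
  where
  lemma : ∀ k → suc (k + k) * (k + k) ≡ 2 * (k * suc (k + k))
  lemma = solve-∀

triangle-even : ∀ k₀ → triangle (suc k₀ + suc k₀) ≡ suc k₀ + k₀ * (suc k₀ + suc k₀)
triangle-even k₀ = *-cancelˡ-≡ _ _ 2 (trans (triangle-double (k₀ + suc k₀)) (lemma k₀))
  where
  lemma : ∀ k₀ → suc (k₀ + suc k₀) * (k₀ + suc k₀) ≡ 2 * (suc k₀ + k₀ * (suc k₀ + suc k₀))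
  lemma = solve-∀

triangle-even-mod : ∀ k .{{_ : NonZero k}} .{{_ : NonZero (k + k)}} → triangle (k + k) % (k + k) ≡ k
triangle-even-mod k@(suc k₀) = begin
  triangle (k + k) % (k + k)              ≡⟨ cong (_% (k + k)) (triangle-even k₀) ⟩
  (k + k₀ * (k + k)) % (k + k)            ≡⟨ [m+kn]%n≡m%n k k₀ (k + k) ⟩
  k % (k + k)                             ≡⟨ m<n⇒m%n≡m (m<m+n k (>-nonZero⁻¹ k)) ⟩
  k                                       ∎
  where open ≡-Reasoning

-- Odd order
sum-id-odd : ∀ k → ℤₙΣ.sum (suc (k + k)) id ≡ 0ₙ
sum-id-odd k = toℕ-injective (begin
  toℕ (ℤₙΣ.sum n id)      ≡⟨ toℕ-sum id ⟩
  triangle n % n          ≡⟨ cong (_% n) (triangle-odd k) ⟩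
  k * n % n               ≡⟨ m*n%n≡0 k n ⟩
  0                       ∎)
  where
  open ≡-Reasoning
  n = suc (k + k)

oddSquare : ∀ k → IsMagicSquare (suc (k + k)) _,_
oddSquare k = involution⇒bijective _ (λ _ → refl) , (0ₙ , 0ₙ) ,
  (λ i → line (λ _ → i) id (sum-const≡0ₙ i) (sum-id-odd k)) ,
  (λ j → line id (λ _ → j) (sum-id-odd k) (sum-const≡0ₙ j)) ,
  line id id (sum-id-odd k) (sum-id-odd k) ,
  line id opposite (sum-id-odd k) (trans sum-opposite (sum-id-odd k))
  where
  open ℤₙΣ (suc (k + k)) using (sum)
  line : (r c : Fin (suc (k + k)) → Fin (suc (k + k))) → sum r ≡ 0ₙ → sum c ≡ 0ₙ →
         sumΓ (λ x → (r x , c x)) ≡ (0ₙ , 0ₙ)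
  line r c r≡0 c≡0 = trans (sumΓ-pair (λ x → (r x , c x))) (cong₂ _,_ r≡0 c≡0)

-- Even order
module Halves (k : ℕ) .{{_ : NonZero k}} where

  instance
    k+k-nonZero : NonZero (k + k)
    k+k-nonZero = >-nonZero (<-≤-trans (>-nonZero⁻¹ k) (m≤m+n k k))

  open ℤₙΣ (k + k) using (sum; ∑-distrib-+)

  merge : Bool × Fin k → Fin (k + k)
  merge (false , a) = a ↑ˡ k
  merge (true  , a) = k ↑ʳ a

  split : Fin (k + k) → Bool × Fin k
  split i = [ (false ,_) , (true ,_) ]′ (splitAt k i)

  split-merge : ∀ p → split (merge p) ≡ p
  split-merge (false , a) = cong [ (false ,_) , (true ,_) ]′ (splitAt-↑ˡ k a k)
  split-merge (true  , a) = cong [ (false ,_) , (true ,_) ]′ (splitAt-↑ʳ k k a)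

  merge-split : ∀ i → merge (split i) ≡ i
  merge-split i = trans (merge-[,] (splitAt k i)) (join-splitAt k k i)
    where
    merge-[,] : ∀ x → merge ([ (false ,_) , (true ,_) ]′ x) ≡ [ _↑ˡ k , k ↑ʳ_ ]′ x
    merge-[,] (inj₁ a) = refl
    merge-[,] (inj₂ a) = refl

  merge-opposite : ∀ s a → opposite (merge (s , a)) ≡ merge (not s , opposite a)
  merge-opposite false a = toℕ-injective (begin
    toℕ (opposite (a ↑ˡ k))           ≡⟨ opposite-prop (a ↑ˡ k) ⟩
    (k + k) ∸ suc (toℕ (a ↑ˡ k))      ≡⟨ cong (λ x → (k + k) ∸ suc x) (toℕ-↑ˡ a k) ⟩
    (k + k) ∸ suc (toℕ a)             ≡⟨ +-∸-assoc k (toℕ<n a) ⟩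
    k + (k ∸ suc (toℕ a))             ≡⟨ cong (k +_) (opposite-prop a) ⟨
    k + toℕ (opposite a)              ≡⟨ toℕ-↑ʳ k (opposite a) ⟨
    toℕ (k ↑ʳ opposite a)             ∎)
    where open ≡-Reasoning
  merge-opposite true a = toℕ-injective (begin
    toℕ (opposite (k ↑ʳ a))           ≡⟨ opposite-prop (k ↑ʳ a) ⟩
    (k + k) ∸ suc (toℕ (k ↑ʳ a))      ≡⟨ cong (λ x → (k + k) ∸ suc x) (toℕ-↑ʳ k a) ⟩
    (k + k) ∸ suc (k + toℕ a)         ≡⟨ cong ((k + k) ∸_) (+-suc k (toℕ a)) ⟨
    (k + k) ∸ (k + suc (toℕ a))       ≡⟨ [m+n]∸[m+o]≡n∸o k k (suc (toℕ a)) ⟩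
    k ∸ suc (toℕ a)                   ≡⟨ opposite-prop a ⟨
    toℕ (opposite a)                  ≡⟨ toℕ-↑ˡ (opposite a) k ⟨
    toℕ (opposite a ↑ˡ k)             ∎)
    where open ≡-Reasoning

  split-opposite : ∀ i → split (opposite i) ≡ (not (proj₁ (split i)) , opposite (proj₂ (split i)))
  split-opposite i = begin
    split (opposite i)                    ≡⟨ cong (split ∘ opposite) (merge-split i) ⟨
    split (opposite (merge (s , a)))      ≡⟨ cong split (merge-opposite s a) ⟩
    split (merge (not s , opposite a))    ≡⟨ split-merge (not s , opposite a) ⟩
    (not s , opposite a)                  ∎
    where
    open ≡-Reasoning
    s = proj₁ (split i)
    a = proj₂ (split i)

  xor-sum-split : (F : Bool × Fin k → Bool) →
                  XorΣ.sum (F ∘ split) ≡ XorΣ.sum (λ a → F (false , a) xor F (true , a))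
  xor-sum-split F = begin
    XorΣ.sum (F ∘ split)
      ≡⟨ sum-↑ (CommutativeMonoid.monoid xor-commutativeMonoid) {k} (F ∘ split) ⟩
    XorΣ.sum (F ∘ split ∘ merge ∘ (false ,_)) xor XorΣ.sum (F ∘ split ∘ merge ∘ (true ,_))
      ≡⟨ cong₂ _xor_ (XorΣ.sum-cong-≗ (cong F ∘ split-merge ∘ (false ,_))) (XorΣ.sum-cong-≗ (cong F ∘ split-merge ∘ (true ,_))) ⟩
    XorΣ.sum (λ a → F (false , a)) xor XorΣ.sum (λ a → F (true , a))
      ≡⟨ XorΣ.∑-distrib-+ (λ a → F (false , a)) (λ a → F (true , a)) ⟨
    XorΣ.sum (λ a → F (false , a) xor F (true , a))
      ∎
    where open ≡-Reasoning

  sum-gated : (x : Fin k → Bool) (γ : Bool → Bool) → γ false xor γ true ≡ true →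
              XorΣ.sum (λ i → x (proj₂ (split i)) ∧ γ (proj₁ (split i))) ≡ XorΣ.sum x
  sum-gated x γ γ-flips = trans (xor-sum-split (λ (s , a) → x a ∧ γ s)) (XorΣ.sum-cong-≗ λ a → begin
    (x a ∧ γ false) xor (x a ∧ γ true)   ≡⟨ ∧-distribˡ-xor (x a) (γ false) (γ true) ⟨
    x a ∧ (γ false xor γ true)           ≡⟨ cong (x a ∧_) γ-flips ⟩
    x a ∧ true                           ≡⟨ ∧-identityʳ (x a) ⟩
    x a                                  ∎)
    where open ≡-Reasoning

  sum-ungated : (x : Fin k → Bool) → XorΣ.sum (λ i → x (proj₂ (split i))) ≡ false
  sum-ungated x = trans (xor-sum-split (x ∘ proj₂))
    (trans (XorΣ.sum-cong-≗ (λ a → xor-same (x a))) (XorΣ.sum-replicate-zero k))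

  half : Fin (k + k)
  half = fromℕ< (m<m+n k (>-nonZero⁻¹ k))

  toℕ-half : toℕ half ≡ k
  toℕ-half = toℕ-fromℕ< _

  half+half≡0 : half +ₙ half ≡ 0ₙ
  half+half≡0 = toℕ-injective (begin
    toℕ (half +ₙ half)              ≡⟨ toℕ-+ₙ half half ⟩
    (toℕ half + toℕ half) % (k + k) ≡⟨ cong (λ x → (x + x) % (k + k)) toℕ-half ⟩
    (k + k) % (k + k)               ≡⟨ n%n≡0 (k + k) ⟩
    0                               ≡⟨ toℕ-0ₙ ⟨
    toℕ (0ₙ {k + k})                ∎)
    where open ≡-Reasoning

  sum-id : sum id ≡ half
  sum-id = toℕ-injective (begin
    toℕ (sum id)                  ≡⟨ toℕ-sum id ⟩
    triangle (k + k) % (k + k)    ≡⟨ triangle-even-mod k ⟩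
    k                             ≡⟨ toℕ-half ⟨
    toℕ half                      ∎)
    where open ≡-Reasoning

  shift : Bool → Fin (k + k)
  shift b = if b then half else 0ₙ

  shift-xor : ∀ b c → shift (b xor c) ≡ shift b +ₙ shift c
  shift-xor false c     = sym (+ₙ-identityˡ (shift c))
  shift-xor true  false = sym (+ₙ-identityʳ half)
  shift-xor true  true  = sym half+half≡0

  sum-shift : ∀ {m} (β : Fin m → Bool) → sum (shift ∘ β) ≡ shift (XorΣ.sum β)
  sum-shift {zero}  β = refl
  sum-shift {suc m} β = trans (cong (shift (β zero) +ₙ_) (sum-shift (β ∘ suc))) (sym (shift-xor (β zero) _))

  sum-+ₙshift : ∀ {m} (ℓ : Fin m → Fin (k + k)) (β : Fin m → Bool) →
                sum (λ x → ℓ x +ₙ shift (β x)) ≡ sum ℓ +ₙ shift (XorΣ.sum β)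
  sum-+ₙshift ℓ β = trans (∑-distrib-+ ℓ (shift ∘ β)) (cong (sum ℓ +ₙ_) (sum-shift β))

  0ₙ+shift-true : ∀ {x : Fin (k + k)} {b} → x ≡ 0ₙ → b ≡ true → x +ₙ shift b ≡ half
  0ₙ+shift-true refl refl = +ₙ-identityˡ half

  half+shift-false : ∀ {x b} → x ≡ half → b ≡ false → x +ₙ shift b ≡ half
  half+shift-false refl refl = +ₙ-identityʳ half

  merge-not : ∀ s a → merge (not s , a) ≡ merge (s , a) +ₙ half
  merge-not false a = toℕ-injective (begin
    toℕ (k ↑ʳ a)                        ≡⟨ toℕ-↑ʳ k a ⟩
    k + toℕ a                           ≡⟨ +-comm k (toℕ a) ⟩
    toℕ a + k                           ≡⟨ m<n⇒m%n≡m (+-monoˡ-< k (toℕ<n a)) ⟨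
    (toℕ a + k) % (k + k)               ≡⟨ cong₂ (λ x y → (x + y) % (k + k)) (toℕ-↑ˡ a k) toℕ-half ⟨
    (toℕ (a ↑ˡ k) + toℕ half) % (k + k) ≡⟨ toℕ-+ₙ (a ↑ˡ k) half ⟨
    toℕ ((a ↑ˡ k) +ₙ half)              ∎)
    where open ≡-Reasoning
  merge-not true a = toℕ-injective (begin
    toℕ (a ↑ˡ k)                        ≡⟨ toℕ-↑ˡ a k ⟩
    toℕ a                               ≡⟨ m<n⇒m%n≡m (<-≤-trans (toℕ<n a) (m≤m+n k k)) ⟨
    toℕ a % (k + k)                     ≡⟨ [m+kn]%n≡m%n (toℕ a) 1 (k + k) ⟨
    (toℕ a + 1 * (k + k)) % (k + k)     ≡⟨ cong (_% (k + k)) (lemma k (toℕ a)) ⟩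
    (k + toℕ a + k) % (k + k)           ≡⟨ cong₂ (λ x y → (x + y) % (k + k)) (toℕ-↑ʳ k a) toℕ-half ⟨
    (toℕ (k ↑ʳ a) + toℕ half) % (k + k) ≡⟨ toℕ-+ₙ (k ↑ʳ a) half ⟨
    toℕ ((k ↑ʳ a) +ₙ half)              ∎)
    where
    open ≡-Reasoning
    lemma : ∀ k a → a + 1 * (k + k) ≡ k + a + k
    lemma = solve-∀

  merge-xor : ∀ b s a → merge (b xor s , a) ≡ merge (s , a) +ₙ shift b
  merge-xor false s a = sym (+ₙ-identityʳ (merge (s , a)))
  merge-xor true  s a = merge-not s a

module ShearSquare (k : ℕ) .{{_ : NonZero k}} (f g : Fin k → Fin k)
  (g∘f-fixedPointFree : ∀ a → g (f a) ≢ a)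
  (f-diagonal     : XorΣ.sum (λ a → does (a ≟ f a)) ≡ false)
  (g-diagonal     : XorΣ.sum (λ a → does (a ≟ g a)) ≡ false)
  (f-antidiagonal : XorΣ.sum (λ a → does (opposite a ≟ f a)) ≡ false)
  (g-antidiagonal : XorΣ.sum (λ a → does (a ≟ g (opposite a))) ≡ false)
  where

  open Halves k
  open ℤₙΣ (k + k) using (sum; sum-cong-≗)

  horizontal vertical : Fin k → Fin k → Bool
  horizontal a b = does (b ≟ f a)
  vertical   a b = does (a ≟ g b)

  horizontal∧vertical≡false : ∀ a b → horizontal a b ∧ vertical a b ≡ false
  horizontal∧vertical≡false a b with b ≟ f a
  ... | no _     = refl
  ... | yes refl = dec-false (a ≟ g (f a)) (g∘f-fixedPointFree a ∘ sym)

  place : Bool × Bool → Fin k → Fin k → Γ (k + k)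
  place (s , t) a b = merge (s , a) , merge (t , b)

  entry : Bool × Fin k → Bool × Fin k → Γ (k + k)
  entry (s , a) (t , b) = place (shear (horizontal a b) (vertical a b) (s , t)) a b

  square : Fin (k + k) → Fin (k + k) → Γ (k + k)
  square i j = entry (split i) (split j)

  entry-involutive : ∀ p q → uncurry square (entry p q) ≡ (merge p , merge q)
  entry-involutive (s , a) (t , b) = begin
    entry (split (merge (s′ , a))) (split (merge (t′ , b)))  ≡⟨ cong₂ entry (split-merge (s′ , a)) (split-merge (t′ , b)) ⟩
    place (shear h v (s′ , t′)) a b                          ≡⟨ cong (λ p → place p a b) (shear-involutive h v h∧v≡false (s , t)) ⟩
    place (s , t) a b                                        ∎
    where
    open ≡-Reasoning
    h = horizontal a b
    v = vertical a b
    h∧v≡false = horizontal∧vertical≡false a b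
    s′ = proj₁ (shear h v (s , t))
    t′ = proj₂ (shear h v (s , t))

  square-involutive : ∀ p → uncurry square (uncurry square p) ≡ p
  square-involutive (i , j) =
    trans (entry-involutive (split i) (split j)) (cong₂ _,_ (merge-split i) (merge-split j))

  flip₁ flip₂ : Bool × Fin k → Bool × Fin k → Bool
  flip₁ (s , a) (t , b) = horizontal a b ∧ t
  flip₂ (s , a) (t , b) = vertical a b ∧ s

  square-shift : ∀ i j → square i j ≡ (i +ₙ shift (flip₁ (split i) (split j)) , j +ₙ shift (flip₂ (split i) (split j)))
  square-shift i j = cong₂ _,_
    (trans (merge-xor φ₁ (proj₁ (split i)) (proj₂ (split i))) (cong (_+ₙ shift φ₁) (merge-split i)))
    (trans (merge-xor φ₂ (proj₁ (split j)) (proj₂ (split j))) (cong (_+ₙ shift φ₂) (merge-split j)))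
    where
    φ₁ = flip₁ (split i) (split j)
    φ₂ = flip₂ (split i) (split j)

  line-sum : ∀ (r c : Fin (k + k) → Fin (k + k)) →
             sum r +ₙ shift (XorΣ.sum (λ x → flip₁ (split (r x)) (split (c x)))) ≡ half →
             sum c +ₙ shift (XorΣ.sum (λ x → flip₂ (split (r x)) (split (c x)))) ≡ half →
             sumΓ (λ x → square (r x) (c x)) ≡ (half , half)
  line-sum r c r-part c-part = trans (sumΓ-pair _) (cong₂ _,_
    (trans (sum-cong-≗ (cong proj₁ ∘ shifted)) (trans (sum-+ₙshift r _) r-part))
    (trans (sum-cong-≗ (cong proj₂ ∘ shifted)) (trans (sum-+ₙshift c _) c-part)))
    where shifted = λ x → square-shift (r x) (c x)

  rows : ∀ i → sumΓ (square i) ≡ (half , half)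
  rows i = line-sum (λ _ → i) id
    (0ₙ+shift-true (sum-const≡0ₙ i) (trans (sum-gated (horizontal a) id refl) (sum-does-≟ (f a))))
    (half+shift-false sum-id (sum-ungated (λ b → vertical a b ∧ s)))
    where
    s = proj₁ (split i)
    a = proj₂ (split i)

  columns : ∀ j → sumΓ (λ i → square i j) ≡ (half , half)
  columns j = line-sum id (λ _ → j)
    (half+shift-false sum-id (sum-ungated (λ a → horizontal a b ∧ t)))
    (0ₙ+shift-true (sum-const≡0ₙ j) (trans (sum-gated (λ a → vertical a b) id refl) (sum-does-≟ (g b))))
    where
    t = proj₁ (split j)
    b = proj₂ (split j)

  diagonal : sumΓ (λ i → square i i) ≡ (half , half)
  diagonal = line-sum id id
    (half+shift-false sum-id (trans (sum-gated (λ a → horizontal a a) id refl) f-diagonal))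
    (half+shift-false sum-id (trans (sum-gated (λ a → vertical a a) id refl) g-diagonal))

  antidiagonal : sumΓ (λ i → square i (opposite i)) ≡ (half , half)
  antidiagonal = line-sum id opposite
    (half+shift-false sum-id
      (trans (reflect flip₁) (trans (sum-gated (λ a → horizontal a (opposite a)) not refl) f-antidiagonal)))
    (half+shift-false (trans sum-opposite sum-id)
      (trans (reflect flip₂) (trans (sum-gated (λ a → vertical a (opposite a)) id refl) g-antidiagonal)))
    where
    reflect : ∀ φ → XorΣ.sum (λ i → φ (split i) (split (opposite i)))
                  ≡ XorΣ.sum (λ i → φ (split i) (not (proj₁ (split i)) , opposite (proj₂ (split i))))
    reflect φ = XorΣ.sum-cong-≗ (λ i → cong (φ (split i)) (split-opposite i))

  isMagicSquare : IsMagicSquare (k + k) square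
  isMagicSquare = involution⇒bijective _ square-involutive , (half , half) , rows , columns , diagonal , antidiagonal

-- f has no fixed point and g fixes 0 and the last index; f meets the reflection at these
-- two points and g never does.
module CornerPattern (m : ℕ) where

  last : Fin (suc (suc m))
  last = fromℕ (suc m)

  f g : Fin (suc (suc m)) → Fin (suc (suc m))
  f zero    = last
  f (suc _) = zero
  g zero    = zero
  g (suc _) = last

  g∘f-fixedPointFree : ∀ a → g (f a) ≢ a
  g∘f-fixedPointFree zero    ()
  g∘f-fixedPointFree (suc a) ()

  f-diagonal : XorΣ.sum (λ a → does (a ≟ f a)) ≡ false
  f-diagonal = XorΣ.sum-replicate-zero (suc m)

  g-diagonal : XorΣ.sum (λ a → does (a ≟ g a)) ≡ false
  g-diagonal = cong (true xor_) (sum-does-≟ (fromℕ m))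

  f-antidiagonal : XorΣ.sum (λ a → does (opposite a ≟ f a)) ≡ false
  f-antidiagonal = cong₂ _xor_ (dec-true (last ≟ last) refl)
    (trans (XorΣ.sum-cong-≗ {suc m} (λ a → does-opposite-≟ (suc a) zero)) (sum-does-≟ (fromℕ m)))

  g∘opposite-fixedPointFree : ∀ a → a ≢ g (opposite a)
  g∘opposite-fixedPointFree a a≡g[ā] with opposite a in ā≡
  ... | zero  = 0≢1+n (trans (sym a≡g[ā]) (trans (sym (opposite-involutive a)) (cong opposite ā≡)))
  ... | suc x = 0≢1+n (trans (sym (opposite-involutive zero)) (trans (cong opposite (sym a≡g[ā])) ā≡))

  g-antidiagonal : XorΣ.sum (λ a → does (a ≟ g (opposite a))) ≡ false
  g-antidiagonal = trans (XorΣ.sum-cong-≗ (λ a → dec-false (a ≟ g (opposite a)) (g∘opposite-fixedPointFree a)))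
                         (XorΣ.sum-replicate-zero (suc (suc m)))

  open ShearSquare (suc (suc m)) f g g∘f-fixedPointFree f-diagonal g-diagonal f-antidiagonal g-antidiagonal
    using (square; isMagicSquare) public

even-or-odd : ∀ n → ∃[ k ] (n ≡ k + k ⊎ n ≡ suc (k + k))
even-or-odd zero = 0 , inj₁ refl
even-or-odd (suc n) with even-or-odd n
... | k , inj₁ n≡2k   = k , inj₂ (cong suc n≡2k)
... | k , inj₂ n≡2k+1 = suc k , inj₁ (trans (cong suc n≡2k+1) (cong suc (sym (+-suc k k))))

mainTheorem6 : (n : ℕ) .{{_ : NonZero n}} → n ≥ 3 →
    ∃[ A ] IsMagicSquare n A
mainTheorem6 n 3≤n with even-or-odd n
... | suc (suc m) , inj₁ refl = CornerPattern.square m , CornerPattern.isMagicSquare m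
... | k           , inj₂ refl = _,_ , oddSquare k
mainTheorem6 _ (s≤s (s≤s ()))       | 1 , inj₁ refl
mainTheorem6 _ ()                   | 0 , inj₁ refl
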